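{- For $n\geqslant 1$ define $\xi_n(x)=\sum_{k\geqslant 0}T(n,2k+1)x^k$ and $\zeta_n(x)=\sum_{k\geqslant 0}2T(n,2k+2)x^k$, so that $\xi_1(x)=1$ and $\zeta_1(x)=0$. Then for all $n\geqslant 1$, $$\xi_{n+1}(x)=(1+(n-1)x)\xi_{n}(x)+2x(1-x)\frac{\mathrm{d}}{\mathrm{d}x}\xi_n(x)+\frac{x}{2}\zeta_n(x),$$ $$\zeta_{n+1}(x)=\left(2+(n-2)x\right)\zeta_n(x)+2x(1-x)\frac{\mathrm{d}}{\mathrm{d}x}\zeta_n(x)+2\xi_n(x).$$
   Context: For a permutation $\pi\in\mathfrak{S}_n$, with the convention $\pi(0)=0$, the number of up-down runs is $\mathrm{udrun}(\pi)=1+\#\{i\in[n-1]:(\pi(i)-\pi(i-1))(\pi(i+1)-\pi(i))<0\}$, i.e. the number of maximal contiguous monotone runs of the word $0\pi(1)\cdots\pi(n)$. $T(n,k)$ is the number of $\pi\in\mathfrak{S}_n$ with $\mathrm{udrun}(\pi)=k$. -}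

module Defs where

open import Data.Nat as ℕ using (ℕ; zero; suc; _<ᵇ_)
open import Data.Nat.Properties using (_≟_)
open import Data.Bool using (Bool; true; false; _∧_; _∨_; if_then_else_)
open import Data.List using (List; []; _∷_; map; concatMap; filter; length; upTo; applyUpTo)
open import Data.List.Relation.Unary.Unique.DecPropositional _≟_ using (unique?)
open import Data.Integer using (+_)
open import Data.Rational as ℚ using (ℚ; _/_; ½)
open import Relation.Binary.PropositionalEquality using (_≡_)

-- Permutations of [n] = {1,…,n}, as one-line words π(1)…π(n).
-- words m n : all words of length m over the alphabet {1,…,n}.

words : ℕ → ℕ → List (List ℕ)
words zero    n = [] ∷ []
words (suc m) n = concatMap (λ w → map (λ a → a ∷ w) (applyUpTo suc n)) (words m n)

perms : ℕ → List (List ℕ)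
perms n = filter unique? (words n n)

turn : ℕ → ℕ → ℕ → Bool
turn a b c = ((a <ᵇ b) ∧ (c <ᵇ b)) ∨ ((b <ᵇ a) ∧ (b <ᵇ c))

turns : List ℕ → ℕ
turns (a ∷ b ∷ c ∷ w) = (if turn a b c then 1 else 0) ℕ.+ turns (b ∷ c ∷ w)
turns _ = 0

-- udrun(π) = 1 + #{ i ∈ [n-1] : (π(i)-π(i-1))(π(i+1)-π(i)) < 0 },  π(0) = 0
udrun : List ℕ → ℕ
udrun π = suc (turns (0 ∷ π))

T : ℕ → ℕ → ℕ
T n k = length (filter (λ π → udrun π ≟ k) (perms n))

Poly : Set
Poly = ℕ → ℚ

fromℕ : ℕ → ℚ
fromℕ m = + m / 1

const : ℚ → Poly
const c zero    = c
const c (suc k) = ℚ.0ℚ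

X : Poly
X 1 = ℚ.1ℚ
X _ = ℚ.0ℚ

infixl 6 _⊕_ _⊖_
infixl 7 _⊗_

_⊕_ : Poly → Poly → Poly
(p ⊕ q) k = p k ℚ.+ q k

sumTo : (ℕ → ℚ) → ℕ → ℚ
sumTo f zero    = f zero
sumTo f (suc k) = sumTo f k ℚ.+ f (suc k)

_⊗_ : Poly → Poly → Poly
(p ⊗ q) k = sumTo (λ i → p i ℚ.* q (k ℕ.∸ i)) k

D : Poly → Poly
D p k = fromℕ (suc k) ℚ.* p (suc k)

infix 4 _≐_
_≐_ : Poly → Poly → Set
p ≐ q = ∀ k → p k ≡ q k

_⊖_ : Poly → Poly → Poly
(p ⊖ q) k = p k ℚ.- q k

ξ : ℕ → Poly
ξ n k = fromℕ (T n (suc (2 ℕ.* k)))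

ζ : ℕ → Poly
ζ n k = fromℕ (2 ℕ.* T n (2 ℕ.+ 2 ℕ.* k))

-- Every π ∈ 𝔖ₙ₊₁ arises from a unique σ ∈ 𝔖ₙ by inserting n+1 into one of n+1 positions.
-- Reading 0σ as a word of ascents and descents, the new maximum turns the step after the
-- insertion point into an ascent followed by a descent.  If udrun σ = k, this leaves the
-- number of runs unchanged at k positions, raises it by one at one position and by two at
-- the remaining n−k positions, one for each interior point of 0σ that is not a turn.  Hence
--   T(n+1,k) = k T(n,k) + T(n,k−1) + (n−k+2) T(n,k−2),
-- and the two recurrences are this identity read off at odd and at even k.

module Submission where

open import Defs
open import Data.Nat using (ℕ; zero; suc; _∸_; _≤_; _<_; _≡ᵇ_; _<ᵇ_; z≤n; s≤s; s≤s⁻¹)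
open import Data.Product using (_×_; _,_; proj₁; proj₂)
open import Data.Rational using (½; 1ℚ; 0ℚ; _-_)
open import Relation.Binary.PropositionalEquality
  using (_≡_; _≢_; refl; sym; trans; cong; cong₂; subst; subst₂; setoid; module ≡-Reasoning)

module Counting where

  open import Data.Bool using (Bool; true; false; not; _xor_; _∧_; _∨_; if_then_else_)
  import Data.Bool as Bool
  open import Data.Nat using (_+_; _*_)
  open import Data.Nat.Properties as ℕ
    using (_≟_; ≡ᵇ⇒≡; <ᵇ-reflects-<; <-cmp; <-asym; ≤-refl; m≤n⇒m≤1+n; m≤m+n; m+n∸m≡n;
           +-suc; +-cancelˡ-≡; *-zeroʳ; *-distribˡ-+)
  open import Data.Nat.ListAction using (sum)
  open import Data.Nat.ListAction.Properties using (sum-++; sum-↭)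
  open import Data.Nat.Tactic.RingSolver using (solve-∀)
  open import Data.List using (List; []; _∷_; _++_; map; concatMap; filter; length; applyUpTo)
  open import Data.List.Properties
    using (map-∘; map-++; map-cong-local; length-applyUpTo; filter-accept; filter-reject; filter-all; filter-none;
           ∷-injectiveˡ; ∷-injectiveʳ)
  open import Data.List.Membership.Propositional using (_∈_; _∉_; find; lose)
  open import Data.List.Membership.Propositional.Properties
    using (∈-concatMap⁺; ∈-concatMap⁻; ∈-map⁺; ∈-map⁻; ∈-applyUpTo⁺; ∈-applyUpTo⁻; ∈-filter⁺; ∈-filter⁻; ∈-∃++)
  open import Data.List.Membership.Propositional.Properties.WithK using (unique∧set⇒bag)
  open import Data.List.Membership.DecPropositional _≟_ using (_∈?_)
  open import Data.List.Relation.Unary.All as All using (All; []; _∷_)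
  open import Data.List.Relation.Unary.Any using (here; there)
  open import Data.List.Relation.Unary.Linked using (Linked; []; [-]; _∷_)
  open import Data.List.Relation.Unary.Linked.Properties using (AllPairs⇒Linked)
  open import Data.List.Relation.Unary.Unique.Propositional using (Unique; []; _∷_)
  import Data.List.Relation.Unary.Unique.Propositional.Properties as Unique
  open import Data.List.Relation.Unary.Unique.DecPropositional _≟_ using (unique?)
  open import Data.List.Relation.Binary.Disjoint.Propositional using (Disjoint)
  open import Data.List.Relation.Binary.Subset.Propositional using (_⊆_)
  open import Data.List.Relation.Binary.Permutation.Propositional
    using (_↭_; ↭-refl; ↭-sym; ↭-trans; ↭-prep; ↭-swap; ↭⇒↭ₛ)
  open import Data.List.Relation.Binary.Permutation.Propositional.Properties
    using (↭-length; All-resp-↭; ∈-resp-↭; shift; map⁺)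
  import Data.List.Relation.Binary.Permutation.Setoid.Properties as Perm
  open import Data.List.Relation.Binary.BagAndSetEquality using (∼bag⇒↭)
  open import Function using (_∘_; mk⇔)
  open import Relation.Binary.Definitions using (tri<; tri≈; tri>)
  open import Relation.Nullary using (¬_; ¬?; yes; no; contradiction)
  open import Relation.Nullary.Reflects using (ofʸ; ofⁿ)

  sumMap : {A : Set} → List A → (A → ℕ) → ℕ
  sumMap xs f = sum (map f xs)

  syntax sumMap xs (λ x → e) = ∑[ x ∈ xs ] e

  bit : Bool → ℕ
  bit b = if b then 1 else 0

  module _ {A : Set} where

    ∑-cong : ∀ {xs} {f g : A → ℕ} → (∀ {x} → x ∈ xs → f x ≡ g x) → ∑[ x ∈ xs ] f x ≡ ∑[ x ∈ xs ] g x
    ∑-cong f≡g = cong sum (map-cong-local (All.tabulate f≡g))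

    ∑-↭ : ∀ {xs ys} (f : A → ℕ) → xs ↭ ys → ∑[ x ∈ xs ] f x ≡ ∑[ x ∈ ys ] f x
    ∑-↭ f xs↭ys = sum-↭ (map⁺ f xs↭ys)

    ∑-map : ∀ {B : Set} (h : B → A) (f : A → ℕ) xs → ∑[ y ∈ map h xs ] f y ≡ ∑[ x ∈ xs ] f (h x)
    ∑-map h f xs = cong sum (sym (map-∘ xs))

    ∑-++ : ∀ (f : A → ℕ) xs ys → ∑[ x ∈ xs ++ ys ] f x ≡ ∑[ x ∈ xs ] f x + ∑[ x ∈ ys ] f x
    ∑-++ f xs ys = trans (cong sum (map-++ f xs ys)) (sum-++ (map f xs) (map f ys))

    ∑-concatMap : ∀ {B : Set} (h : B → List A) (f : A → ℕ) xs →
      ∑[ z ∈ concatMap h xs ] f z ≡ ∑[ x ∈ xs ] ∑[ z ∈ h x ] f z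
    ∑-concatMap h f []       = refl
    ∑-concatMap h f (x ∷ xs) =
      trans (∑-++ f (h x) (concatMap h xs)) (cong (∑[ z ∈ h x ] f z +_) (∑-concatMap h f xs))

    ∑-+ : ∀ (f g : A → ℕ) xs → ∑[ x ∈ xs ] (f x + g x) ≡ ∑[ x ∈ xs ] f x + ∑[ x ∈ xs ] g x
    ∑-+ f g []       = refl
    ∑-+ f g (x ∷ xs) = trans (cong (f x + g x +_) (∑-+ f g xs)) (interchange (f x) (g x) _ _)
      where
      interchange : ∀ a b c d → a + b + (c + d) ≡ a + c + (b + d)
      interchange = solve-∀

    ∑-*ˡ : ∀ c (f : A → ℕ) xs → ∑[ x ∈ xs ] (c * f x) ≡ c * ∑[ x ∈ xs ] f x
    ∑-*ˡ c f []       = sym (*-zeroʳ c)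
    ∑-*ˡ c f (x ∷ xs) = trans (cong (c * f x +_) (∑-*ˡ c f xs)) (sym (*-distribˡ-+ c (f x) _))

    ∑-linear : ∀ a c (f g h : A → ℕ) xs →
      ∑[ x ∈ xs ] (a * f x + g x + c * h x) ≡ a * ∑[ x ∈ xs ] f x + ∑[ x ∈ xs ] g x + c * ∑[ x ∈ xs ] h x
    ∑-linear a c f g h xs =
      trans (∑-+ _ _ xs) (cong₂ _+_ (trans (∑-+ _ _ xs) (cong (_+ _) (∑-*ˡ a f xs))) (∑-*ˡ c h xs))

    -- does (m ≟ n) computes to m ≡ᵇ n, so abstracting over h x ≡ᵇ k unfolds the filter.
    count-as-∑ : ∀ (h : A → ℕ) k xs → length (filter (λ x → h x ≟ k) xs) ≡ ∑[ x ∈ xs ] bit (h x ≡ᵇ k)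
    count-as-∑ h k []       = refl
    count-as-∑ h k (x ∷ xs) with h x ≡ᵇ k
    ... | true  = cong suc (count-as-∑ h k xs)
    ... | false = count-as-∑ h k xs

  indicator-weight : ∀ (f : ℕ → ℕ) u k → f u * bit (u ≡ᵇ k) ≡ f k * bit (u ≡ᵇ k)
  indicator-weight f u k with u ≡ᵇ k in u≡ᵇk
  ... | true  = cong (λ v → f v * 1) (≡ᵇ⇒≡ u k (subst Bool.T (sym u≡ᵇk) _))
  ... | false = trans (*-zeroʳ (f u)) (sym (*-zeroʳ (f k)))

  changes : List Bool → ℕ
  changes (x ∷ y ∷ s) = bit (x xor y) + changes (y ∷ s)
  changes _           = 0

  flats : List Bool → ℕ
  flats (x ∷ y ∷ s) = bit (not (x xor y)) + flats (y ∷ s)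
  flats _           = 0

  changes+flats : ∀ x s → changes (x ∷ s) + flats (x ∷ s) ≡ length s
  changes+flats x []      = refl
  changes+flats x (y ∷ s) with x xor y
  ... | true  = cong suc (changes+flats y s)
  ... | false = trans (+-suc (changes (y ∷ s)) _) (cong suc (changes+flats y s))

  -- The patterns of a word after inserting a new maximum at each position: the step
  -- following the insertion point becomes an ascent and a descent (at the end, an ascent).
  peaks : List Bool → List (List Bool)
  peaks []      = (true ∷ []) ∷ []
  peaks (x ∷ s) = (true ∷ false ∷ s) ∷ map (x ∷_) (peaks s)

  -- ∑ g over the turn counts of peaks (x ∷ s), with t = changes (x ∷ s) and p = flats (x ∷ s):
  -- t + bit x insertions keep t turns, 2 ∸ bit x add one, and each of the p non-turning
  -- points yields one insertion adding two.
  peakWeight : Bool → ℕ → ℕ → (ℕ → ℕ) → ℕ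
  peakWeight true  t p g = suc t * g t + g (suc t) + p * g (2 + t)
  peakWeight false t p g = t * g t + 2 * g (suc t) + p * g (2 + t)

  ∑-peaks-∷∷ : ∀ (g : ℕ → ℕ) x y r → ∑[ s ∈ peaks (x ∷ y ∷ r) ] g (changes s) ≡
    g (changes (true ∷ false ∷ y ∷ r)) +
    (g (changes (x ∷ true ∷ false ∷ r)) + ∑[ s ∈ map (y ∷_) (peaks r) ] g (bit (x xor y) + changes s))
  ∑-peaks-∷∷ g x y r = cong (λ R → g (changes (true ∷ false ∷ y ∷ r)) + (g (changes (x ∷ true ∷ false ∷ r)) + R))
                            (prepend (peaks r))
    where
    prepend : ∀ L → ∑[ s ∈ map (x ∷_) (map (y ∷_) L) ] g (changes s) ≡
                    ∑[ s ∈ map (y ∷_) L ] g (bit (x xor y) + changes s)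
    prepend []      = refl
    prepend (s ∷ L) = cong (g (changes (x ∷ y ∷ s)) +_) (prepend L)

  ∑-peaks : ∀ (g : ℕ → ℕ) x s →
    ∑[ s′ ∈ peaks (x ∷ s) ] g (changes s′) ≡ peakWeight x (changes (x ∷ s)) (flats (x ∷ s)) g
  ∑-peaks g true  [] = rearrange (g 0) (g 1) (g 2)
    where
    rearrange : ∀ a b c → b + (a + 0) ≡ 1 * a + b + 0 * c
    rearrange = solve-∀
  ∑-peaks g false [] = rearrange (g 0) (g 1) (g 2)
    where
    rearrange : ∀ a b c → b + (b + 0) ≡ 0 * a + 2 * b + 0 * c
    rearrange = solve-∀
  ∑-peaks g true (true ∷ r) = begin
    _                                      ≡⟨ ∑-peaks-∷∷ g true true r ⟩
    g (2 + t) + (g (changes (true ∷ false ∷ r)) + R)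
                                           ≡⟨ cong (g (2 + t) +_) (∑-peaks g true r) ⟩
    g (2 + t) + peakWeight true t p g      ≡⟨ rearrange t p (g t) (g (1 + t)) (g (2 + t)) ⟩
    peakWeight true t (suc p) g            ∎
    where
    open ≡-Reasoning
    t = changes (true ∷ r)
    p = flats (true ∷ r)
    R = ∑[ s ∈ map (true ∷_) (peaks r) ] g (changes s)
    rearrange : ∀ t p a b c → c + (suc t * a + b + p * c) ≡ suc t * a + b + suc p * c
    rearrange = solve-∀
  ∑-peaks g false (true ∷ r) = begin
    _                                      ≡⟨ ∑-peaks-∷∷ g false true r ⟩
    g (2 + t) + (g (suc (changes (true ∷ false ∷ r))) + R)
                                           ≡⟨ cong (g (2 + t) +_) (∑-peaks (g ∘ suc) true r) ⟩
    g (2 + t) + peakWeight true t p (g ∘ suc)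
                                           ≡⟨ rearrange t p (g (1 + t)) (g (2 + t)) (g (3 + t)) ⟩
    peakWeight false (suc t) p g           ∎
    where
    open ≡-Reasoning
    t = changes (true ∷ r)
    p = flats (true ∷ r)
    R = ∑[ s ∈ map (true ∷_) (peaks r) ] g (suc (changes s))
    rearrange : ∀ t p a b c → b + (suc t * a + b + p * c) ≡ suc t * a + 2 * b + p * c
    rearrange = solve-∀
  ∑-peaks g false (false ∷ r) = begin
    _                                      ≡⟨ ∑-peaks-∷∷ g false false r ⟩
    g (suc t) + (g (2 + t) + R)            ≡⟨ swap (g (suc t)) (g (2 + t)) R ⟩
    g (2 + t) + (g (suc t) + R)            ≡⟨ cong (g (2 + t) +_) (∑-peaks g false r) ⟩
    g (2 + t) + peakWeight false t p g     ≡⟨ rearrange t p (g t) (g (1 + t)) (g (2 + t)) ⟩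
    peakWeight false t (suc p) g           ∎
    where
    open ≡-Reasoning
    t = changes (false ∷ r)
    p = flats (false ∷ r)
    R = ∑[ s ∈ map (false ∷_) (peaks r) ] g (changes s)
    swap : ∀ a b c → a + (b + c) ≡ b + (a + c)
    swap = solve-∀
    rearrange : ∀ t p a b c → c + (t * a + 2 * b + p * c) ≡ t * a + 2 * b + suc p * c
    rearrange = solve-∀
  -- The hypothesis also counts an insertion at the head of the tail, which has no
  -- counterpart here: its weight g (2 + t) is cancelled.
  ∑-peaks g true (false ∷ r) = +-cancelˡ-≡ (g (2 + t)) _ _ (begin
    _                                      ≡⟨ cong (g (2 + t) +_) (∑-peaks-∷∷ g true false r) ⟩
    g (2 + t) + (g (suc t) + (g (suc t) + R))
                                           ≡⟨ swap (g (2 + t)) (g (suc t)) R ⟩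
    g (suc t) + (g (suc t) + (g (2 + t) + R))
                                           ≡⟨ cong (λ W → g (suc t) + (g (suc t) + W))
                                                   (∑-peaks (g ∘ suc) false r) ⟩
    g (suc t) + (g (suc t) + peakWeight false t p (g ∘ suc))
                                           ≡⟨ rearrange t p (g (1 + t)) (g (2 + t)) (g (3 + t)) ⟩
    g (2 + t) + peakWeight true (suc t) p g ∎)
    where
    open ≡-Reasoning
    t = changes (false ∷ r)
    p = flats (false ∷ r)
    R = ∑[ s ∈ map (false ∷_) (peaks r) ] g (suc (changes s))
    swap : ∀ a b c → a + (b + (b + c)) ≡ b + (b + (a + c))
    swap = solve-∀
    rearrange : ∀ t p a b c → a + (a + (t * a + 2 * b + p * c)) ≡ b + (suc (suc t) * a + b + p * c)
    rearrange = solve-∀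

  steps : List ℕ → List Bool
  steps (a ∷ b ∷ w) = (a <ᵇ b) ∷ steps (b ∷ w)
  steps _           = []

  length-steps : ∀ a w → length (steps (a ∷ w)) ≡ length w
  length-steps a []      = refl
  length-steps a (b ∷ w) = cong suc (length-steps b w)

  <ᵇ-true : ∀ {a b} → a < b → (a <ᵇ b) ≡ true
  <ᵇ-true {a} {b} a<b with a <ᵇ b | <ᵇ-reflects-< a b
  ... | true  | _       = refl
  ... | false | ofⁿ a≮b = contradiction a<b a≮b

  <ᵇ-false : ∀ {a b} → ¬ a < b → (a <ᵇ b) ≡ false
  <ᵇ-false {a} {b} a≮b with a <ᵇ b | <ᵇ-reflects-< a b
  ... | true  | ofʸ a<b = contradiction a<b a≮b
  ... | false | _       = refl

  <ᵇ-flip : ∀ {a b} → a ≢ b → (b <ᵇ a) ≡ not (a <ᵇ b)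
  <ᵇ-flip {a} {b} a≢b with <-cmp a b
  ... | tri< a<b _ b≮a = trans (<ᵇ-false b≮a) (cong not (sym (<ᵇ-true a<b)))
  ... | tri≈ _ a≡b _   = contradiction a≡b a≢b
  ... | tri> a≮b _ b<a = trans (<ᵇ-true b<a) (cong not (sym (<ᵇ-false a≮b)))

  turn-xor : ∀ {a b c} → a ≢ b → b ≢ c → turn a b c ≡ (a <ᵇ b) xor (b <ᵇ c)
  turn-xor {a} {b} {c} a≢b b≢c rewrite <ᵇ-flip a≢b | <ᵇ-flip b≢c = peak-or-valley (a <ᵇ b) (b <ᵇ c)
    where
    peak-or-valley : ∀ x y → (x ∧ not y) ∨ (not x ∧ y) ≡ x xor y
    peak-or-valley true  true  = refl
    peak-or-valley true  false = refl
    peak-or-valley false y     = refl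

  turns-steps : ∀ {w} → Linked _≢_ w → turns w ≡ changes (steps w)
  turns-steps []                = refl
  turns-steps [-]               = refl
  turns-steps (_ ∷ [-])         = refl
  turns-steps (a≢b ∷ b≢c ∷ bcw) = cong₂ _+_ (cong bit (turn-xor a≢b b≢c)) (turns-steps (b≢c ∷ bcw))

  insertions : {A : Set} → A → List A → List (List A)
  insertions M []      = (M ∷ []) ∷ []
  insertions M (a ∷ w) = (M ∷ a ∷ w) ∷ map (a ∷_) (insertions M w)

  steps-insertions : ∀ {M a w} → All (_< M) (a ∷ w) →
    map (λ z → steps (a ∷ z)) (insertions M w) ≡ peaks (steps (a ∷ w))
  steps-insertions {w = []} (a<M ∷ []) = cong (λ x → (x ∷ []) ∷ []) (<ᵇ-true a<M)
  steps-insertions {M} {a} {b ∷ w} (a<M ∷ b<M ∷ w<M) = cong₂ _∷_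
    (cong₂ (λ x y → x ∷ y ∷ steps (b ∷ w)) (<ᵇ-true a<M) (<ᵇ-false (<-asym b<M)))
    (begin
      map (λ z → steps (a ∷ z)) (map (b ∷_) (insertions M w))  ≡⟨ map-∘ (insertions M w) ⟨
      map (λ z → (a <ᵇ b) ∷ steps (b ∷ z)) (insertions M w)     ≡⟨ map-∘ (insertions M w) ⟩
      map ((a <ᵇ b) ∷_) (map (λ z → steps (b ∷ z)) (insertions M w))
        ≡⟨ cong (map ((a <ᵇ b) ∷_)) (steps-insertions (b<M ∷ w<M)) ⟩
      map ((a <ᵇ b) ∷_) (peaks (steps (b ∷ w)))                 ∎)
    where open ≡-Reasoning

  module _ {A B : Set} {f : A → List B} where

    Unique-concatMap : ∀ {xs} → Unique xs → (∀ {x} → x ∈ xs → Unique (f x)) →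
      (∀ {x y z} → x ∈ xs → y ∈ xs → z ∈ f x → z ∈ f y → x ≡ y) → Unique (concatMap f xs)
    Unique-concatMap {[]}     _            _  _      = []
    Unique-concatMap {x ∷ xs} (x∉xs ∷ !xs) !f shared =
      Unique.++⁺ (!f (here refl)) (Unique-concatMap !xs (!f ∘ there) (λ p q → shared (there p) (there q))) disjoint
      where
      disjoint : Disjoint (f x) (concatMap f xs)
      disjoint (z∈fx , z∈rest) with y , y∈xs , z∈fy ← find (∈-concatMap⁻ f z∈rest) =
        All.lookup x∉xs y∈xs (shared (here refl) (there y∈xs) z∈fx z∈fy)

  unique∧⊆⇒length≤ : ∀ {A : Set} {xs ys : List A} → Unique xs → xs ⊆ ys → length xs ≤ length ys
  unique∧⊆⇒length≤ {xs = []}     _            _   = z≤n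
  unique∧⊆⇒length≤ {xs = x ∷ xs} (x∉xs ∷ !xs) sub with us , vs , refl ← ∈-∃++ (sub (here refl)) =
    subst (length (x ∷ xs) ≤_) (sym (↭-length (shift x us vs))) (s≤s (unique∧⊆⇒length≤ !xs xs⊆))
    where
    xs⊆ : xs ⊆ us ++ vs
    xs⊆ z∈xs with ∈-resp-↭ (shift x us vs) (sub (there z∈xs))
    ... | here z≡x   = contradiction (sym z≡x) (All.lookup x∉xs z∈xs)
    ... | there z∈uv = z∈uv

  InRange : ℕ → ℕ → Set
  InRange n a = 1 ≤ a × a ≤ n

  InRange-pred : ∀ {n a} → InRange (suc n) a → a ≢ suc n → InRange n a
  InRange-pred (1≤a , a≤1+n) a≢1+n = 1≤a , s≤s⁻¹ (ℕ.≤∧≢⇒< a≤1+n a≢1+n)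

  ∈-letters⁻ : ∀ {n a} → a ∈ applyUpTo suc n → InRange n a
  ∈-letters⁻ a∈ with i , i<n , refl ← ∈-applyUpTo⁻ suc a∈ = s≤s z≤n , i<n

  ∈-letters⁺ : ∀ {n a} → InRange n a → a ∈ applyUpTo suc n
  ∈-letters⁺ {a = suc i} (_ , i<n) = ∈-applyUpTo⁺ suc i<n

  extensions : ℕ → List ℕ → List (List ℕ)
  extensions n w = map (_∷ w) (applyUpTo suc n)

  ∈-words⁻ : ∀ m {n w} → w ∈ words m n → length w ≡ m × All (InRange n) w
  ∈-words⁻ zero    (here refl) = refl , []
  ∈-words⁻ (suc m) {n} a∷w∈ with find (∈-concatMap⁻ (extensions n) {words m n} a∷w∈)
  ... | w , w∈ , a∷w∈′ with ∈-map⁻ (_∷ w) a∷w∈′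
  ...   | a , a∈ , refl = cong suc (proj₁ (∈-words⁻ m w∈)) , ∈-letters⁻ a∈ ∷ proj₂ (∈-words⁻ m w∈)

  ∈-words⁺ : ∀ m {n w} → length w ≡ m → All (InRange n) w → w ∈ words m n
  ∈-words⁺ zero    {w = []}    refl []        = here refl
  ∈-words⁺ (suc m) {w = a ∷ w} ℓ    (a∈ ∷ w∈) =
    ∈-concatMap⁺ (extensions _) (lose (∈-words⁺ m (ℕ.suc-injective ℓ) w∈) (∈-map⁺ (_∷ w) (∈-letters⁺ a∈)))

  Unique-words : ∀ m n → Unique (words m n)
  Unique-words zero    n = [] ∷ []
  Unique-words (suc m) n = Unique-concatMap (Unique-words m n) (λ _ → Unique.map⁺ ∷-injectiveˡ letters!) shared
    where
    letters! : Unique (applyUpTo suc n)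
    letters! = Unique.applyUpTo⁺₁ suc n (λ i<j _ → ℕ.<⇒≢ (s≤s i<j))
    shared : ∀ {w w′ z} → w ∈ words m n → w′ ∈ words m n → z ∈ extensions n w → z ∈ extensions n w′ → w ≡ w′
    shared _ _ z∈ z∈′ with ∈-map⁻ (_∷ _) z∈ | ∈-map⁻ (_∷ _) z∈′
    ... | _ , _ , refl | _ , _ , eq = ∷-injectiveʳ eq

  record IsPerm (n : ℕ) (π : List ℕ) : Set where
    field
      length≡ : length π ≡ n
      inRange : All (InRange n) π
      unique  : Unique π

  ∈-perms⁻ : ∀ {n π} → π ∈ perms n → IsPerm n π
  ∈-perms⁻ {n} π∈ with w∈ , !π ← ∈-filter⁻ unique? {xs = words n n} π∈ =
    record { length≡ = proj₁ (∈-words⁻ n w∈) ; inRange = proj₂ (∈-words⁻ n w∈) ; unique = !π }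

  ∈-perms⁺ : ∀ {n π} → IsPerm n π → π ∈ perms n
  ∈-perms⁺ {n} P = ∈-filter⁺ unique? (∈-words⁺ n length≡ inRange) unique
    where open IsPerm P

  Unique-perms : ∀ n → Unique (perms n)
  Unique-perms n = Unique.filter⁺ unique? (Unique-words n n)

  IsPerm-resp-↭ : ∀ {n π π′} → π ↭ π′ → IsPerm n π → IsPerm n π′
  IsPerm-resp-↭ π↭π′ P = record
    { length≡ = trans (sym (↭-length π↭π′)) length≡
    ; inRange = All-resp-↭ π↭π′ inRange
    ; unique  = Perm.Unique-resp-↭ (setoid ℕ) (↭⇒↭ₛ π↭π′) unique
    }
    where open IsPerm P

  IsPerm-∷ : ∀ {n π} → IsPerm n π → IsPerm (suc n) (suc n ∷ π)
  IsPerm-∷ P = record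
    { length≡ = cong suc length≡
    ; inRange = (s≤s z≤n , ≤-refl) ∷ All.map (λ (1≤a , a≤n) → 1≤a , m≤n⇒m≤1+n a≤n) inRange
    ; unique  = All.map (λ (_ , a≤n) → ℕ.>⇒≢ (s≤s a≤n)) inRange ∷ unique
    }
    where open IsPerm P

  IsPerm-∷⁻ : ∀ {n π} → IsPerm (suc n) (suc n ∷ π) → IsPerm n π
  IsPerm-∷⁻ P with n∉π ∷ !π ← IsPerm.unique P | _ ∷ π-range ← IsPerm.inRange P = record
    { length≡ = ℕ.suc-injective (IsPerm.length≡ P)
    ; inRange = All.zipWith (λ (a-range , 1+n≢a) → InRange-pred a-range (1+n≢a ∘ sym)) (π-range , n∉π)
    ; unique  = !π
    }

  suc∉ : ∀ {n π} → IsPerm n π → suc n ∉ π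
  suc∉ {n} P n∈π = ℕ.n≮n n (proj₂ (All.lookup (IsPerm.inRange P) n∈π))

  suc∈ : ∀ {n z} → IsPerm (suc n) z → suc n ∈ z
  suc∈ {n} {z} P with suc n ∈? z
  ... | yes n∈z = n∈z
  ... | no  n∉z =
    contradiction (subst₂ _≤_ length≡ (length-applyUpTo suc n) (unique∧⊆⇒length≤ unique z⊆)) (ℕ.n≮n n)
    where
    open IsPerm P
    z⊆ : z ⊆ applyUpTo suc n
    z⊆ a∈z = ∈-letters⁺ (InRange-pred (All.lookup inRange a∈z) (λ a≡1+n → n∉z (subst (_∈ z) a≡1+n a∈z)))

  module _ {M : ℕ} where

    ∈-insertions⁻ : ∀ {w z} → z ∈ insertions M w → z ↭ M ∷ w
    ∈-insertions⁻ {[]}    (here refl) = ↭-refl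
    ∈-insertions⁻ {a ∷ w} (here refl) = ↭-refl
    ∈-insertions⁻ {a ∷ w} (there z∈) with z′ , z′∈ , refl ← ∈-map⁻ (a ∷_) z∈ =
      ↭-trans (↭-prep a (∈-insertions⁻ z′∈)) (↭-swap a M ↭-refl)

    ∈-insertions⁺ : ∀ xs ys → xs ++ M ∷ ys ∈ insertions M (xs ++ ys)
    ∈-insertions⁺ []       []      = here refl
    ∈-insertions⁺ []       (_ ∷ _) = here refl
    ∈-insertions⁺ (x ∷ xs) ys      = there (∈-map⁺ (x ∷_) (∈-insertions⁺ xs ys))

    Unique-insertions : ∀ {w} → M ∉ w → Unique (insertions M w)
    Unique-insertions {[]}    _   = [] ∷ []
    Unique-insertions {a ∷ w} M∉w =
      All.tabulate front≢ ∷ Unique.map⁺ ∷-injectiveʳ (Unique-insertions (M∉w ∘ there))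
      where
      front≢ : ∀ {z} → z ∈ map (a ∷_) (insertions M w) → M ∷ a ∷ w ≢ z
      front≢ z∈ eq with _ , _ , refl ← ∈-map⁻ (a ∷_) z∈ = M∉w (here (∷-injectiveˡ eq))

    remove : List ℕ → List ℕ
    remove = filter (λ a → ¬? (a ≟ M))

    remove-insertions : ∀ {w z} → M ∉ w → z ∈ insertions M w → remove z ≡ w
    remove-insertions {[]}    _   (here refl) = filter-reject (λ a → ¬? (a ≟ M)) (λ M≢M → M≢M refl)
    remove-insertions {a ∷ w} M∉w (here refl) =
      trans (filter-reject (λ a → ¬? (a ≟ M)) (λ M≢M → M≢M refl))
            (filter-all (λ a → ¬? (a ≟ M)) (All.tabulate (λ b∈ b≡M → M∉w (subst (_∈ a ∷ w) b≡M b∈))))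
    remove-insertions {a ∷ w} M∉w (there z∈) with z′ , z′∈ , refl ← ∈-map⁻ (a ∷_) z∈ =
      trans (filter-accept (λ a → ¬? (a ≟ M)) (λ a≡M → M∉w (here (sym a≡M))))
            (cong (a ∷_) (remove-insertions (M∉w ∘ there) z′∈))

  perms-suc↭ : ∀ n → perms (suc n) ↭ concatMap (insertions (suc n)) (perms n)
  perms-suc↭ n = ∼bag⇒↭ (unique∧set⇒bag (Unique-perms (suc n)) Unique-blocks (mk⇔ to from))
    where
    n∉ : ∀ {π} → π ∈ perms n → suc n ∉ π
    n∉ = suc∉ ∘ ∈-perms⁻
    Unique-blocks : Unique (concatMap (insertions (suc n)) (perms n))
    Unique-blocks = Unique-concatMap (Unique-perms n) (Unique-insertions ∘ n∉)
      (λ π∈ π′∈ z∈ z∈′ → trans (sym (remove-insertions (n∉ π∈) z∈)) (remove-insertions (n∉ π′∈) z∈′))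
    to : ∀ {z} → z ∈ perms (suc n) → z ∈ concatMap (insertions (suc n)) (perms n)
    to z∈ with xs , ys , refl ← ∈-∃++ (suc∈ {n} (∈-perms⁻ z∈)) =
      ∈-concatMap⁺ (insertions (suc n))
        (lose (∈-perms⁺ (IsPerm-∷⁻ (IsPerm-resp-↭ (shift (suc n) xs ys) (∈-perms⁻ z∈)))) (∈-insertions⁺ xs ys))
    from : ∀ {z} → z ∈ concatMap (insertions (suc n)) (perms n) → z ∈ perms (suc n)
    from z∈ with π , π∈ , z∈ins ← find (∈-concatMap⁻ (insertions (suc n)) {perms n} z∈) =
      ∈-perms⁺ (IsPerm-resp-↭ (↭-sym (∈-insertions⁻ z∈ins)) (IsPerm-∷ (∈-perms⁻ π∈)))

  udrun-steps : ∀ {n π} → IsPerm n π → udrun π ≡ suc (changes (steps (0 ∷ π)))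
  udrun-steps P = cong suc (turns-steps (AllPairs⇒Linked (All.map (ℕ.<⇒≢ ∘ proj₁) inRange ∷ unique)))
    where open IsPerm P

  ∑-insertions : ∀ {n π} → 1 ≤ n → IsPerm n π → (g : ℕ → ℕ) →
    ∑[ z ∈ insertions (suc n) π ] g (udrun z) ≡
    udrun π * g (udrun π) + g (suc (udrun π)) + (n ∸ udrun π) * g (2 + udrun π)
  ∑-insertions {π = []}        1≤n P g = contradiction (subst (1 ≤_) (sym (IsPerm.length≡ P)) 1≤n) λ ()
  ∑-insertions {π = zero ∷ _}  1≤n P g with (() , _) ∷ _ ← IsPerm.inRange P
  ∑-insertions {n} {suc b ∷ σ} 1≤n P g = begin
    ∑[ z ∈ insertions (suc n) π ] g (udrun z)
      ≡⟨ ∑-cong (λ z∈ → cong g (udrun-steps (IsPerm-resp-↭ (↭-sym (∈-insertions⁻ z∈)) (IsPerm-∷ P)))) ⟩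
    ∑[ z ∈ insertions (suc n) π ] g (suc (changes (steps (0 ∷ z))))
      ≡⟨ ∑-map (λ z → steps (0 ∷ z)) (λ s′ → g (suc (changes s′))) (insertions (suc n) π) ⟨
    ∑[ s′ ∈ map (λ z → steps (0 ∷ z)) (insertions (suc n) π) ] g (suc (changes s′))
      ≡⟨ cong (λ L → ∑[ s′ ∈ L ] g (suc (changes s′)))
              (steps-insertions (s≤s z≤n ∷ All.map (s≤s ∘ proj₂) (IsPerm.inRange P))) ⟩
    ∑[ s′ ∈ peaks (true ∷ s) ] g (suc (changes s′))
      ≡⟨ ∑-peaks (g ∘ suc) true s ⟩
    peakWeight true t p (g ∘ suc)
      ≡⟨ cong₂ (λ u q → u * g u + g (suc u) + q * g (2 + u)) (sym (udrun-steps P)) p≡n∸u ⟩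
    udrun π * g (udrun π) + g (suc (udrun π)) + (n ∸ udrun π) * g (2 + udrun π) ∎
    where
    open ≡-Reasoning
    π = suc b ∷ σ
    s = steps π
    t = changes (true ∷ s)
    p = flats (true ∷ s)
    p≡n∸u : p ≡ n ∸ udrun π
    p≡n∸u = trans (sym (m+n∸m≡n (suc t) p))
      (cong₂ _∸_ (trans (cong suc (trans (changes+flats true s) (length-steps (suc b) σ))) (IsPerm.length≡ P))
                 (sym (udrun-steps P)))

  ∑-udrun-suc : ∀ {n} → 1 ≤ n → (g : ℕ → ℕ) →
    ∑[ z ∈ perms (suc n) ] g (udrun z) ≡
    ∑[ π ∈ perms n ] (udrun π * g (udrun π) + g (suc (udrun π)) + (n ∸ udrun π) * g (2 + udrun π))
  ∑-udrun-suc {n} 1≤n g = begin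
    ∑[ z ∈ perms (suc n) ] g (udrun z)
      ≡⟨ ∑-↭ (g ∘ udrun) (perms-suc↭ n) ⟩
    ∑[ z ∈ concatMap (insertions (suc n)) (perms n) ] g (udrun z)
      ≡⟨ ∑-concatMap (insertions (suc n)) (g ∘ udrun) (perms n) ⟩
    ∑[ π ∈ perms n ] ∑[ z ∈ insertions (suc n) π ] g (udrun z)
      ≡⟨ ∑-cong (λ π∈ → ∑-insertions 1≤n (∈-perms⁻ π∈) g) ⟩
    ∑[ π ∈ perms n ] (udrun π * g (udrun π) + g (suc (udrun π)) + (n ∸ udrun π) * g (2 + udrun π)) ∎
    where open ≡-Reasoning

  T-as-∑ : ∀ n k → T n k ≡ ∑[ π ∈ perms n ] bit (udrun π ≡ᵇ k)
  T-as-∑ n k = count-as-∑ udrun k (perms n)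

  T-suc-suc : ∀ {n} → 1 ≤ n → ∀ k → T (suc n) (2 + k) ≡ (2 + k) * T n (2 + k) + T n (1 + k) + (n ∸ k) * T n k
  T-suc-suc {n} 1≤n k = begin
    T (suc n) (2 + k)
      ≡⟨ T-as-∑ (suc n) (2 + k) ⟩
    ∑[ z ∈ perms (suc n) ] 𝟙 (2 + k) (udrun z)
      ≡⟨ ∑-udrun-suc 1≤n (𝟙 (2 + k)) ⟩
    ∑[ π ∈ perms n ] (udrun π * 𝟙 (2 + k) (udrun π) + 𝟙 (1 + k) (udrun π) + (n ∸ udrun π) * 𝟙 k (udrun π))
      ≡⟨ ∑-cong {xs = perms n} (λ {π} _ → cong₂ (λ a c → a + 𝟙 (1 + k) (udrun π) + c)
                                                (indicator-weight (λ u → u) (udrun π) (2 + k))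
                                                (indicator-weight (n ∸_) (udrun π) k)) ⟩
    ∑[ π ∈ perms n ] ((2 + k) * 𝟙 (2 + k) (udrun π) + 𝟙 (1 + k) (udrun π) + (n ∸ k) * 𝟙 k (udrun π))
      ≡⟨ ∑-linear (2 + k) (n ∸ k) (𝟙 (2 + k) ∘ udrun) (𝟙 (1 + k) ∘ udrun) (𝟙 k ∘ udrun) (perms n) ⟩
    (2 + k) * ∑[ π ∈ perms n ] 𝟙 (2 + k) (udrun π) + ∑[ π ∈ perms n ] 𝟙 (1 + k) (udrun π)
      + (n ∸ k) * ∑[ π ∈ perms n ] 𝟙 k (udrun π)
      ≡⟨ cong₂ _+_ (cong₂ _+_ (cong ((2 + k) *_) (T-as-∑ n (2 + k))) (T-as-∑ n (1 + k)))
                   (cong ((n ∸ k) *_) (T-as-∑ n k)) ⟨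
    (2 + k) * T n (2 + k) + T n (1 + k) + (n ∸ k) * T n k ∎
    where
    open ≡-Reasoning
    𝟙 : ℕ → ℕ → ℕ
    𝟙 j u = bit (u ≡ᵇ j)

  T-suc-one : ∀ {n} → 1 ≤ n → T (suc n) 1 ≡ T n 1
  T-suc-one {n} 1≤n = begin
    T (suc n) 1                                   ≡⟨ T-as-∑ (suc n) 1 ⟩
    ∑[ z ∈ perms (suc n) ] bit (udrun z ≡ᵇ 1)     ≡⟨ ∑-udrun-suc 1≤n (λ u → bit (u ≡ᵇ 1)) ⟩
    ∑[ π ∈ perms n ] (udrun π * bit (udrun π ≡ᵇ 1) + bit (udrun π ≡ᵇ 0) + (n ∸ udrun π) * 0)
      ≡⟨ ∑-cong {xs = perms n} (λ {π} _ → collapse (turns (0 ∷ π)) (n ∸ udrun π)) ⟩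
    ∑[ π ∈ perms n ] bit (udrun π ≡ᵇ 1)           ≡⟨ T-as-∑ n 1 ⟨
    T n 1                                         ∎
    where
    open ≡-Reasoning
    collapse : ∀ t m → suc t * bit (t ≡ᵇ 0) + 0 + m * 0 ≡ bit (t ≡ᵇ 0)
    collapse zero    m = cong suc (*-zeroʳ m)
    collapse (suc t) m = cong₂ (λ a b → a + 0 + b) (*-zeroʳ (suc (suc t))) (*-zeroʳ m)

  T-zero : ∀ n → T n 0 ≡ 0
  T-zero n = cong length (filter-none (λ π → udrun π ≟ 0) {xs = perms n} (All.tabulate (λ _ ())))

  udrun-≤ : ∀ {n π} → 1 ≤ n → IsPerm n π → udrun π ≤ n
  udrun-≤ {π = []}        1≤n P = contradiction (subst (1 ≤_) (sym (IsPerm.length≡ P)) 1≤n) λ ()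
  udrun-≤ {n} {a ∷ σ} 1≤n P = subst₂ _≤_ (sym (udrun-steps P)) n≡ (m≤m+n (suc (changes s)) (flats s))
    where
    s = steps (0 ∷ a ∷ σ)
    n≡ : suc (changes s + flats s) ≡ n
    n≡ = trans (cong suc (trans (changes+flats (0 <ᵇ a) (steps (a ∷ σ))) (length-steps a σ))) (IsPerm.length≡ P)

  T-above : ∀ {n k} → 1 ≤ n → n < k → T n k ≡ 0
  T-above {n} {k} 1≤n n<k = cong length (filter-none (λ π → udrun π ≟ k) {xs = perms n}
    (All.tabulate (λ π∈ u≡k → ℕ.<-irrefl u≡k (ℕ.≤-<-trans (udrun-≤ 1≤n (∈-perms⁻ π∈)) n<k))))

module Coefficients where

  open import Data.Nat as ℕ using ()
  import Data.Nat.Properties as ℕ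
  open import Data.Nat.Coprimality using (1-coprimeTo) renaming (sym to coprime-sym)
  import Data.Integer as ℤ
  import Data.Integer.Properties as ℤ
  open import Data.Rational using (ℚ; mkℚ; _+_; _*_; -_)
  open import Data.Rational.Properties
    using (+-*-commutativeRing; _≟_; normalize-coprime; /-cong; +-assoc; +-identityˡ; +-identityʳ;
           *-assoc; *-identityʳ; *-zeroˡ; *-zeroʳ; *-distribˡ-+)
  open import Relation.Nullary.Decidable using (dec⇒maybe; yes; no)
  open import Tactic.RingSolver using (solve-∀)
  open import Tactic.RingSolver.Core.AlmostCommutativeRing using (AlmostCommutativeRing; fromCommutativeRing)
  open import Level using (0ℓ)
  open Counting using (T-suc-suc; T-suc-one; T-zero; T-above)

  ℚ-ring : AlmostCommutativeRing 0ℓ 0ℓ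
  ℚ-ring = fromCommutativeRing +-*-commutativeRing (λ x → dec⇒maybe (0ℚ ≟ x))

  -- Rewriting with fromℕ-mkℚ makes ℚ's _+_ and _*_ compute to a quotient by 1.
  fromℕ-mkℚ : ∀ m → fromℕ m ≡ mkℚ (ℤ.+ m) 0 (coprime-sym (1-coprimeTo m))
  fromℕ-mkℚ m = normalize-coprime (coprime-sym (1-coprimeTo m))

  fromℕ-+ : ∀ m n → fromℕ (m ℕ.+ n) ≡ fromℕ m + fromℕ n
  fromℕ-+ m n rewrite fromℕ-mkℚ m | fromℕ-mkℚ n =
    sym (/-cong (cong₂ ℤ._+_ (ℤ.*-identityʳ (ℤ.+ m)) (ℤ.*-identityʳ (ℤ.+ n))) refl)

  fromℕ-* : ∀ m n → fromℕ (m ℕ.* n) ≡ fromℕ m * fromℕ n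
  fromℕ-* m n rewrite fromℕ-mkℚ m | fromℕ-mkℚ n = sym (/-cong (sym (ℤ.pos-* m n)) refl)

  fromℕ-∸ : ∀ {m n} → n ≤ m → fromℕ (m ∸ n) ≡ fromℕ m - fromℕ n
  fromℕ-∸ {m} {n} n≤m = begin
    fromℕ (m ∸ n)                     ≡⟨ cancel (fromℕ (m ∸ n)) (fromℕ n) ⟩
    fromℕ (m ∸ n) + fromℕ n - fromℕ n ≡⟨ cong (_- fromℕ n) (fromℕ-+ (m ∸ n) n) ⟨
    fromℕ (m ∸ n ℕ.+ n) - fromℕ n     ≡⟨ cong (λ k → fromℕ k - fromℕ n) (ℕ.m∸n+n≡m n≤m) ⟩
    fromℕ m - fromℕ n                 ∎
    where
    open ≡-Reasoning
    cancel : ∀ x y → x ≡ x + y - y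
    cancel = solve-∀ ℚ-ring

  fromℕ-c+2* : ∀ c j → fromℕ (c ℕ.+ 2 ℕ.* j) ≡ fromℕ c + fromℕ 2 * fromℕ j
  fromℕ-c+2* c j = trans (fromℕ-+ c (2 ℕ.* j)) (cong (fromℕ c +_) (fromℕ-* 2 j))

  shift : Poly → Poly
  shift p k = p (suc k)

  sumTo-suc : ∀ (f : ℕ → ℚ) k → sumTo f (suc k) ≡ f 0 + sumTo (λ i → f (suc i)) k
  sumTo-suc f zero    = refl
  sumTo-suc f (suc k) = trans (cong (_+ f (2 ℕ.+ k)) (sumTo-suc f k)) (+-assoc (f 0) _ _)

  sumTo-cong : ∀ {f g : ℕ → ℚ} → (∀ i → f i ≡ g i) → ∀ k → sumTo f k ≡ sumTo g k
  sumTo-cong f≡g zero    = f≡g 0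
  sumTo-cong f≡g (suc k) = cong₂ _+_ (sumTo-cong f≡g k) (f≡g (suc k))

  sumTo-scale : ∀ c (f : ℕ → ℚ) k → sumTo (λ i → c * f i) k ≡ c * sumTo f k
  sumTo-scale c f zero    = refl
  sumTo-scale c f (suc k) = trans (cong (_+ c * f (suc k)) (sumTo-scale c f k)) (sym (*-distribˡ-+ c _ _))

  ⊗-suc : ∀ p q k → (p ⊗ q) (suc k) ≡ p 0 * q (suc k) + (shift p ⊗ q) k
  ⊗-suc p q k = sumTo-suc (λ i → p i * q (suc k ∸ i)) k

  ⊗-congˡ : ∀ {p p′} → p ≐ p′ → ∀ q → p ⊗ q ≐ p′ ⊗ q
  ⊗-congˡ p≐p′ q k = sumTo-cong (λ i → cong (_* q (k ∸ i)) (p≐p′ i)) k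

  ⊗-scaleˡ : ∀ c p q k → ((λ i → c * p i) ⊗ q) k ≡ c * (p ⊗ q) k
  ⊗-scaleˡ c p q k = trans (sumTo-cong (λ i → *-assoc c (p i) _) k) (sumTo-scale c _ k)

  ⊗-zeroˡ : ∀ q k → ((λ _ → 0ℚ) ⊗ q) k ≡ 0ℚ
  ⊗-zeroˡ q k = trans (sumTo-scale 0ℚ (λ i → q (k ∸ i)) k) (*-zeroˡ (sumTo (λ i → q (k ∸ i)) k))

  const-⊗ : ∀ c q k → (const c ⊗ q) k ≡ c * q k
  const-⊗ c q zero    = refl
  const-⊗ c q (suc k) =
    trans (⊗-suc (const c) q k) (trans (cong (λ x → c * q (suc k) + x) (⊗-zeroˡ q k)) (+-identityʳ _))

  ⊗-affineˡ : ∀ p {a b} → p 0 ≡ a → shift p ≐ const b → ∀ q k → (p ⊗ q) (suc k) ≡ a * q (suc k) + b * q k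
  ⊗-affineˡ p {b = b} p0≡a shift≐b q k =
    trans (⊗-suc p q k) (cong₂ _+_ (cong (_* _) p0≡a) (trans (⊗-congˡ shift≐b q k) (const-⊗ b q k)))

  scaledX-shift : ∀ c → shift (const c ⊗ X) ≐ const c
  scaledX-shift c zero    = trans (const-⊗ c X 1) (*-identityʳ c)
  scaledX-shift c (suc i) = trans (const-⊗ c X (2 ℕ.+ i)) (*-zeroʳ c)

  scaledX-⊗-suc : ∀ c q k → (const c ⊗ X ⊗ q) (suc k) ≡ c * q k
  scaledX-⊗-suc c q k = trans (⊗-affineˡ (const c ⊗ X) (*-zeroʳ c) (scaledX-shift c) q k)
                              (trans (cong (_+ c * q k) (*-zeroˡ (q (suc k)))) (+-identityˡ (c * q k)))

  linear-shift : ∀ a b → shift (const a ⊕ const b ⊗ X) ≐ const b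
  linear-shift a b i = trans (+-identityˡ _) (scaledX-shift b i)

  1-X-shift : shift (const 1ℚ ⊖ X) ≐ const (- 1ℚ)
  1-X-shift zero    = refl
  1-X-shift (suc i) = refl

  1-X⊗D : ∀ q k → ((const 1ℚ ⊖ X) ⊗ D q) k ≡ fromℕ (suc k) * q (suc k) - fromℕ k * q k
  1-X⊗D q zero    = rearrange (q 1) (q 0)
    where
    rearrange : ∀ x y → (1ℚ - 0ℚ) * (fromℕ 1 * x) ≡ fromℕ 1 * x - fromℕ 0 * y
    rearrange = solve-∀ ℚ-ring
  1-X⊗D q (suc k) = trans (⊗-affineˡ (const 1ℚ ⊖ X) refl 1-X-shift (D q) k)
                          (rearrange (fromℕ (2 ℕ.+ k)) (q (2 ℕ.+ k)) (fromℕ (suc k)) (q (suc k)))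
    where
    rearrange : ∀ a x b y → 1ℚ * (a * x) + (- 1ℚ) * (b * y) ≡ a * x - b * y
    rearrange = solve-∀ ℚ-ring

  cubic-⊗-suc : ∀ q k → (const (fromℕ 2) ⊗ X ⊗ (const 1ℚ ⊖ X) ⊗ q) (suc k) ≡ fromℕ 2 * ((const 1ℚ ⊖ X) ⊗ q) k
  cubic-⊗-suc q k = begin
    (C ⊗ q) (suc k)
      ≡⟨ ⊗-suc C q k ⟩
    0ℚ * q (suc k) + (shift C ⊗ q) k
      ≡⟨ cong₂ _+_ (*-zeroˡ (q (suc k))) (⊗-congˡ (scaledX-⊗-suc (fromℕ 2) (const 1ℚ ⊖ X)) q k) ⟩
    0ℚ + ((λ i → fromℕ 2 * (const 1ℚ ⊖ X) i) ⊗ q) k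
      ≡⟨ +-identityˡ _ ⟩
    ((λ i → fromℕ 2 * (const 1ℚ ⊖ X) i) ⊗ q) k
      ≡⟨ ⊗-scaleˡ (fromℕ 2) (const 1ℚ ⊖ X) q k ⟩
    fromℕ 2 * ((const 1ℚ ⊖ X) ⊗ q) k ∎
    where
    open ≡-Reasoning
    C = const (fromℕ 2) ⊗ X ⊗ (const 1ℚ ⊖ X)

  recurrenceRHS : ℚ → ℚ → Poly → Poly → Poly
  recurrenceRHS a b q r = (const a ⊕ const b ⊗ X) ⊗ q ⊕ const (fromℕ 2) ⊗ X ⊗ (const 1ℚ ⊖ X) ⊗ D q ⊕ r

  recurrenceRHS-zero : ∀ a b q r → recurrenceRHS a b q r 0 ≡ a * q 0 + r 0
  recurrenceRHS-zero a b q r = rearrange a b (q 0) (D q 0) (r 0)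
    where
    rearrange : ∀ a b x d r → (a + b * 0ℚ) * x + 0ℚ * d + r ≡ a * x + r
    rearrange = solve-∀ ℚ-ring

  recurrenceRHS-suc : ∀ a b q r k {ρ} → r (suc k) ≡ ρ → recurrenceRHS a b q r (suc k) ≡
    a * q (suc k) + b * q k + fromℕ 2 * ((1ℚ + fromℕ k) * q (suc k) - fromℕ k * q k) + ρ
  recurrenceRHS-suc a b q r k r≡ρ = cong₂ _+_ (cong₂ _+_
    (⊗-affineˡ (const a ⊕ const b ⊗ X) (trans (cong (a +_) (*-zeroʳ b)) (+-identityʳ a)) (linear-shift a b) q k)
    (trans (cubic-⊗-suc (D q) k)
           (cong (fromℕ 2 *_) (trans (1-X⊗D q k) (cong (λ c → c * q (suc k) - fromℕ k * q k) (fromℕ-+ 1 k))))))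
    r≡ρ

  -- For k > n the truncated n ∸ k is not n - k, but then T n k = 0.
  fromℕ-∸-* : ∀ {n} → 1 ≤ n → ∀ k → fromℕ ((n ∸ k) ℕ.* T n k) ≡ (fromℕ n - fromℕ k) * fromℕ (T n k)
  fromℕ-∸-* {n} 1≤n k with k ℕ.≤? n
  ... | yes k≤n = trans (fromℕ-* (n ∸ k) (T n k)) (cong (_* fromℕ (T n k)) (fromℕ-∸ k≤n))
  ... | no  k≰n rewrite T-above 1≤n (ℕ.≰⇒> k≰n) =
    trans (cong fromℕ (ℕ.*-zeroʳ (n ∸ k))) (sym (*-zeroʳ (fromℕ n - fromℕ k)))

  T-suc-suc-ℚ : ∀ {n} → 1 ≤ n → ∀ k → fromℕ (T (suc n) (2 ℕ.+ k)) ≡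
    (fromℕ 2 + fromℕ k) * fromℕ (T n (2 ℕ.+ k)) + fromℕ (T n (1 ℕ.+ k)) + (fromℕ n - fromℕ k) * fromℕ (T n k)
  T-suc-suc-ℚ {n} 1≤n k = begin
    fromℕ (T (suc n) (2 ℕ.+ k))
      ≡⟨ cong fromℕ (T-suc-suc 1≤n k) ⟩
    fromℕ (a ℕ.+ b ℕ.+ c)
      ≡⟨ trans (fromℕ-+ (a ℕ.+ b) c) (cong₂ _+_ (fromℕ-+ a b) (fromℕ-∸-* 1≤n k)) ⟩
    fromℕ a + fromℕ b + (fromℕ n - fromℕ k) * fromℕ (T n k)
      ≡⟨ cong (λ x → x + fromℕ b + (fromℕ n - fromℕ k) * fromℕ (T n k))
              (trans (fromℕ-* (2 ℕ.+ k) (T n (2 ℕ.+ k))) (cong (_* fromℕ (T n (2 ℕ.+ k))) (fromℕ-+ 2 k))) ⟩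
    (fromℕ 2 + fromℕ k) * fromℕ (T n (2 ℕ.+ k)) + fromℕ b + (fromℕ n - fromℕ k) * fromℕ (T n k) ∎
    where
    open ≡-Reasoning
    a = (2 ℕ.+ k) ℕ.* T n (2 ℕ.+ k)
    b = T n (1 ℕ.+ k)
    c = (n ∸ k) ℕ.* T n k

  T-odd-suc : ∀ n j → fromℕ (T n (3 ℕ.+ 2 ℕ.* j)) ≡ ξ n (suc j)
  T-odd-suc n j = cong (λ i → fromℕ (T n (suc i))) (sym (ℕ.*-suc 2 j))

  T-even : ∀ n j → fromℕ (T n (2 ℕ.+ 2 ℕ.* j)) ≡ ½ * ζ n j
  T-even n j = trans (half-double _) (cong (½ *_) (sym (fromℕ-* 2 (T n (2 ℕ.+ 2 ℕ.* j)))))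
    where
    half-double : ∀ x → x ≡ ½ * (fromℕ 2 * x)
    half-double = solve-∀ ℚ-ring

  T-even-suc : ∀ n j → fromℕ (T n (4 ℕ.+ 2 ℕ.* j)) ≡ ½ * ζ n (suc j)
  T-even-suc n j = trans (cong (λ i → fromℕ (T n (2 ℕ.+ i))) (sym (ℕ.*-suc 2 j))) (T-even n (suc j))

  ξ-suc : ∀ {n} → 1 ≤ n → ∀ j → ξ (suc n) (suc j) ≡
    (fromℕ 3 + fromℕ 2 * fromℕ j) * ξ n (suc j) + ½ * ζ n j + (fromℕ n - (1ℚ + fromℕ 2 * fromℕ j)) * ξ n j
  ξ-suc {n} 1≤n j = begin
    ξ (suc n) (suc j)
      ≡⟨ T-odd-suc (suc n) j ⟨
    fromℕ (T (suc n) (2 ℕ.+ k))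
      ≡⟨ T-suc-suc-ℚ 1≤n k ⟩
    (fromℕ 2 + fromℕ k) * fromℕ (T n (2 ℕ.+ k)) + fromℕ (T n (1 ℕ.+ k)) + (N - fromℕ k) * ξ n j
      ≡⟨ cong₂ (λ (K , A) B → (fromℕ 2 + K) * A + B + (N - K) * ξ n j)
               (cong₂ _,_ (fromℕ-c+2* 1 j) (T-odd-suc n j)) (T-even n j) ⟩
    (fromℕ 2 + (1ℚ + fromℕ 2 * J)) * ξ n (suc j) + ½ * ζ n j + (N - (1ℚ + fromℕ 2 * J)) * ξ n j
      ≡⟨ cong (λ c → c * ξ n (suc j) + ½ * ζ n j + (N - (1ℚ + fromℕ 2 * J)) * ξ n j) (rearrange J) ⟩
    (fromℕ 3 + fromℕ 2 * J) * ξ n (suc j) + ½ * ζ n j + (N - (1ℚ + fromℕ 2 * J)) * ξ n j ∎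
    where
    open ≡-Reasoning
    k = 1 ℕ.+ 2 ℕ.* j
    N = fromℕ n
    J = fromℕ j
    rearrange : ∀ J → fromℕ 2 + (1ℚ + fromℕ 2 * J) ≡ fromℕ 3 + fromℕ 2 * J
    rearrange = solve-∀ ℚ-ring

  ζ-zero : ∀ {n} → 1 ≤ n → ζ (suc n) 0 ≡ fromℕ 2 * ζ n 0 + fromℕ 2 * ξ n 0
  ζ-zero {n} 1≤n = begin
    ζ (suc n) 0
      ≡⟨ trans (fromℕ-* 2 (T (suc n) 2)) (cong (fromℕ 2 *_) (T-suc-suc-ℚ 1≤n 0)) ⟩
    fromℕ 2 * ((fromℕ 2 + fromℕ 0) * fromℕ (T n 2) + ξ n 0 + (N - fromℕ 0) * fromℕ (T n 0))
      ≡⟨ cong₂ (λ A t → fromℕ 2 * ((fromℕ 2 + fromℕ 0) * A + ξ n 0 + (N - fromℕ 0) * fromℕ t))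
               (T-even n 0) (T-zero n) ⟩
    fromℕ 2 * ((fromℕ 2 + fromℕ 0) * (½ * ζ n 0) + ξ n 0 + (N - fromℕ 0) * fromℕ 0)
      ≡⟨ rearrange N (ζ n 0) (ξ n 0) ⟩
    fromℕ 2 * ζ n 0 + fromℕ 2 * ξ n 0 ∎
    where
    open ≡-Reasoning
    N = fromℕ n
    rearrange : ∀ N z x →
      fromℕ 2 * ((fromℕ 2 + fromℕ 0) * (½ * z) + x + (N - fromℕ 0) * fromℕ 0) ≡ fromℕ 2 * z + fromℕ 2 * x
    rearrange = solve-∀ ℚ-ring

  ζ-suc : ∀ {n} → 1 ≤ n → ∀ j → ζ (suc n) (suc j) ≡
    (fromℕ 4 + fromℕ 2 * fromℕ j) * ζ n (suc j) + fromℕ 2 * ξ n (suc j)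
      + (fromℕ n - (fromℕ 2 + fromℕ 2 * fromℕ j)) * ζ n j
  ζ-suc {n} 1≤n j = begin
    ζ (suc n) (suc j)
      ≡⟨ fromℕ-* 2 (T (suc n) (2 ℕ.+ 2 ℕ.* suc j)) ⟩
    fromℕ 2 * fromℕ (T (suc n) (2 ℕ.+ 2 ℕ.* suc j))
      ≡⟨ cong (λ i → fromℕ 2 * fromℕ (T (suc n) (2 ℕ.+ i))) (ℕ.*-suc 2 j) ⟩
    fromℕ 2 * fromℕ (T (suc n) (2 ℕ.+ k))
      ≡⟨ cong (fromℕ 2 *_) (T-suc-suc-ℚ 1≤n k) ⟩
    fromℕ 2 * ((fromℕ 2 + fromℕ k) * fromℕ (T n (2 ℕ.+ k)) + fromℕ (T n (1 ℕ.+ k)) + (N - fromℕ k) * fromℕ (T n k))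
      ≡⟨ cong₂ (λ (K , A) (B , C) → fromℕ 2 * ((fromℕ 2 + K) * A + B + (N - K) * C))
               (cong₂ _,_ (fromℕ-c+2* 2 j) (T-even-suc n j)) (cong₂ _,_ (T-odd-suc n j) (T-even n j)) ⟩
    fromℕ 2 * ((fromℕ 2 + (fromℕ 2 + fromℕ 2 * J)) * (½ * ζ n (suc j)) + ξ n (suc j)
               + (N - (fromℕ 2 + fromℕ 2 * J)) * (½ * ζ n j))
      ≡⟨ rearrange N J (ζ n (suc j)) (ξ n (suc j)) (ζ n j) ⟩
    (fromℕ 4 + fromℕ 2 * J) * ζ n (suc j) + fromℕ 2 * ξ n (suc j) + (N - (fromℕ 2 + fromℕ 2 * J)) * ζ n j ∎
    where
    open ≡-Reasoning
    k = 2 ℕ.+ 2 ℕ.* j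
    N = fromℕ n
    J = fromℕ j
    rearrange : ∀ N J z′ x z →
      fromℕ 2 * ((fromℕ 2 + (fromℕ 2 + fromℕ 2 * J)) * (½ * z′) + x
                 + (N - (fromℕ 2 + fromℕ 2 * J)) * (½ * z)) ≡
      (fromℕ 4 + fromℕ 2 * J) * z′ + fromℕ 2 * x + (N - (fromℕ 2 + fromℕ 2 * J)) * z
    rearrange = solve-∀ ℚ-ring

  ξ-recurrence : ∀ {n} → 1 ≤ n → ξ (suc n) ≐ recurrenceRHS 1ℚ (fromℕ n - 1ℚ) (ξ n) (const ½ ⊗ X ⊗ ζ n)
  ξ-recurrence {n} 1≤n zero = begin
    ξ (suc n) 0                  ≡⟨ cong fromℕ (T-suc-one 1≤n) ⟩
    ξ n 0                        ≡⟨ rearrange (ξ n 0) (ζ n 0) ⟩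
    1ℚ * ξ n 0 + 0ℚ * ζ n 0      ≡⟨ recurrenceRHS-zero 1ℚ (fromℕ n - 1ℚ) (ξ n) (const ½ ⊗ X ⊗ ζ n) ⟨
    recurrenceRHS 1ℚ (fromℕ n - 1ℚ) (ξ n) (const ½ ⊗ X ⊗ ζ n) 0 ∎
    where
    open ≡-Reasoning
    rearrange : ∀ x z → x ≡ 1ℚ * x + 0ℚ * z
    rearrange = solve-∀ ℚ-ring
  ξ-recurrence {n} 1≤n (suc j) = begin
    ξ (suc n) (suc j)
      ≡⟨ ξ-suc 1≤n j ⟩
    (fromℕ 3 + fromℕ 2 * J) * ξ n (suc j) + ½ * ζ n j + (N - (1ℚ + fromℕ 2 * J)) * ξ n j
      ≡⟨ rearrange N J (ξ n (suc j)) (ξ n j) (ζ n j) ⟩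
    1ℚ * ξ n (suc j) + (N - 1ℚ) * ξ n j + fromℕ 2 * ((1ℚ + J) * ξ n (suc j) - J * ξ n j) + ½ * ζ n j
      ≡⟨ recurrenceRHS-suc 1ℚ (N - 1ℚ) (ξ n) (const ½ ⊗ X ⊗ ζ n) j (scaledX-⊗-suc ½ (ζ n) j) ⟨
    recurrenceRHS 1ℚ (N - 1ℚ) (ξ n) (const ½ ⊗ X ⊗ ζ n) (suc j) ∎
    where
    open ≡-Reasoning
    N = fromℕ n
    J = fromℕ j
    rearrange : ∀ N J x′ x z →
      (fromℕ 3 + fromℕ 2 * J) * x′ + ½ * z + (N - (1ℚ + fromℕ 2 * J)) * x ≡
      1ℚ * x′ + (N - 1ℚ) * x + fromℕ 2 * ((1ℚ + J) * x′ - J * x) + ½ * z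
    rearrange = solve-∀ ℚ-ring

  ζ-recurrence : ∀ {n} → 1 ≤ n →
    ζ (suc n) ≐ recurrenceRHS (fromℕ 2) (fromℕ n - fromℕ 2) (ζ n) (const (fromℕ 2) ⊗ ξ n)
  ζ-recurrence {n} 1≤n zero =
    trans (ζ-zero 1≤n) (sym (recurrenceRHS-zero (fromℕ 2) (fromℕ n - fromℕ 2) (ζ n) (const (fromℕ 2) ⊗ ξ n)))
  ζ-recurrence {n} 1≤n (suc j) = begin
    ζ (suc n) (suc j)
      ≡⟨ ζ-suc 1≤n j ⟩
    (fromℕ 4 + fromℕ 2 * J) * ζ n (suc j) + fromℕ 2 * ξ n (suc j) + (N - (fromℕ 2 + fromℕ 2 * J)) * ζ n j
      ≡⟨ rearrange N J (ζ n (suc j)) (ζ n j) (ξ n (suc j)) ⟩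
    fromℕ 2 * ζ n (suc j) + (N - fromℕ 2) * ζ n j + fromℕ 2 * ((1ℚ + J) * ζ n (suc j) - J * ζ n j)
      + fromℕ 2 * ξ n (suc j)
      ≡⟨ recurrenceRHS-suc (fromℕ 2) (N - fromℕ 2) (ζ n) (const (fromℕ 2) ⊗ ξ n) j
                           (const-⊗ (fromℕ 2) (ξ n) (suc j)) ⟨
    recurrenceRHS (fromℕ 2) (N - fromℕ 2) (ζ n) (const (fromℕ 2) ⊗ ξ n) (suc j) ∎
    where
    open ≡-Reasoning
    N = fromℕ n
    J = fromℕ j
    rearrange : ∀ N J z′ z x →
      (fromℕ 4 + fromℕ 2 * J) * z′ + fromℕ 2 * x + (N - (fromℕ 2 + fromℕ 2 * J)) * z ≡
      fromℕ 2 * z′ + (N - fromℕ 2) * z + fromℕ 2 * ((1ℚ + J) * z′ - J * z) + fromℕ 2 * x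
    rearrange = solve-∀ ℚ-ring

open Coefficients using (ξ-recurrence; ζ-recurrence)

proposition2 : (ξ 1 ≐ const 1ℚ) × (ζ 1 ≐ const 0ℚ) ×
    (∀ (n : ℕ) → 1 ≤ n →
      (ξ (suc n) ≐ (const 1ℚ ⊕ const (fromℕ n - 1ℚ) ⊗ X) ⊗ ξ n
                   ⊕ const (fromℕ 2) ⊗ X ⊗ (const 1ℚ ⊖ X) ⊗ D (ξ n)
                   ⊕ const ½ ⊗ X ⊗ ζ n)
      × (ζ (suc n) ≐ (const (fromℕ 2) ⊕ const (fromℕ n - fromℕ 2) ⊗ X) ⊗ ζ n
                   ⊕ const (fromℕ 2) ⊗ X ⊗ (const 1ℚ ⊖ X) ⊗ D (ζ n)
                   ⊕ const (fromℕ 2) ⊗ ξ n))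
proposition2 = ξ-one , ζ-one , λ n 1≤n → ξ-recurrence 1≤n , ζ-recurrence 1≤n
  where
  ξ-one : ξ 1 ≐ const 1ℚ
  ξ-one zero    = refl
  ξ-one (suc k) = refl
  ζ-one : ζ 1 ≐ const 0ℚ
  ζ-one zero    = refl
  ζ-one (suc k) = refl
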